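{- Let $G=(V,E)$ be a graph and let $C_1',C_2'\subset V$ be nonempty with $C_1'\cap C_2'=\emptyset$. Let $U=V\setminus(C_1'\cup C_2')$ and $v\in U$. If $v$ is not satisfied with respect to $\{C_1'\cup(U\cap N[v]),\,C_2'\cup(U\setminus N[v])\}$, then $G$ admits no generalized $2$-community structure $\{C_1,C_2\}$ with $C_1'\cup\{v\}\subseteq C_1$ and $C_2'\subseteq C_2$.
   Context: $N[v]=N(v)\cup\{v\}$; $N_C(v)$ is the set of neighbours of $v$ in $C$. For a partition $\{D_1,D_2\}$ of $V$ and $v\in D_i$, $v$ is satisfied with respect to $\{D_1,D_2\}$ if $|N_{D_i}(v)|\cdot|D_{3-i}|\ge |N_{D_{3-i}}(v)|\cdot(|D_i|-1)$. A generalized $2$-community structure of $G$ is a partition of $V$ into two nonempty sets $C_1,C_2$ with respect to which every vertex is satisfied. -}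

module Defs where

open import Data.Nat using (ℕ; _*_; _≥_; _∸_)
open import Data.Bool using (Bool; true; false)
open import Data.Fin using (Fin)
open import Data.Fin.Subset using (Subset; _∈_; _∉_; _∩_; _∪_; ∁; ⁅_⁆; ∣_∣; _⊆_; Nonempty; Empty; ⊥)
open import Data.Vec using (tabulate)
open import Data.Product using (_×_)
open import Relation.Binary.PropositionalEquality using (_≡_)

record Graph (n : ℕ) : Set where
  field
    adj   : Fin n → Fin n → Bool
    sym   : ∀ u v → adj u v ≡ adj v u
    irrefl : ∀ v → adj v v ≡ false

open Graph public

N : ∀ {n} → Graph n → Fin n → Subset n
N G v = tabulate (adj G v)

N[_,_] : ∀ {n} → Graph n → Fin n → Subset n
N[ G , v ] = N G v ∪ ⁅ v ⁆

NIn : ∀ {n} → Graph n → Subset n → Fin n → Subset n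
NIn G C v = N G v ∩ C

_∖_ : ∀ {n} → Subset n → Subset n → Subset n
A ∖ B = A ∩ ∁ B

-- {D₁, D₂} is a partition of V (blocks possibly empty here; nonemptiness
-- is required separately where the paper requires it)
IsPartition : ∀ {n} → Subset n → Subset n → Set
IsPartition D₁ D₂ = (D₁ ∩ D₂ ≡ ⊥) × (∀ x → x ∈ D₁ ∪ D₂)

-- v ∈ Dᵢ is satisfied w.r.t. {Dᵢ, Dⱼ}:
--   |N_{Dᵢ}(v)| · |Dⱼ| ≥ |N_{Dⱼ}(v)| · (|Dᵢ| - 1)
-- (since v ∈ Dᵢ, |Dᵢ| ≥ 1, so truncated subtraction is exact)
SatisfiedIn : ∀ {n} → Graph n → Fin n → (Dᵢ Dⱼ : Subset n) → Set
SatisfiedIn G v Dᵢ Dⱼ =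
  ∣ NIn G Dᵢ v ∣ * ∣ Dⱼ ∣ ≥ ∣ NIn G Dⱼ v ∣ * (∣ Dᵢ ∣ ∸ 1)

Satisfied : ∀ {n} → Graph n → Fin n → (D₁ D₂ : Subset n) → Set
Satisfied G v D₁ D₂ =
  (v ∈ D₁ → SatisfiedIn G v D₁ D₂) × (v ∈ D₂ → SatisfiedIn G v D₂ D₁)

Gen2CS : ∀ {n} → Graph n → Subset n → Subset n → Set
Gen2CS G C₁ C₂ =
  Nonempty C₁ × Nonempty C₂ × IsPartition C₁ C₂ × (∀ x → Satisfied G x C₁ C₂)

-- Let D₁ = C₁′ ∪ (U ∩ N[v]) and t = |N(v) ∩ D₁ ∖ C₁|.  Every neighbour of v in C₁
-- lies in D₁, and every vertex of D₁ outside C₁ is a neighbour of v (it is not in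
-- C₁′, so it lies in N[v], and it is not v ∈ C₁).  Hence |N_{D₁}(v)| = |N_{C₁}(v)| + t
-- and |D₁| ≤ |C₁| + t.  For v ∈ Dᵢ, satisfaction reads
-- deg(v)·(|Dᵢ| − 1) ≤ |N_{Dᵢ}(v)|·(n − 1), and as deg(v) ≤ n − 1,
--   deg(v)(|D₁| − 1) ≤ deg(v)(|C₁| − 1) + deg(v)·t ≤ (|N_{C₁}(v)| + t)(n − 1)
--                   = |N_{D₁}(v)|(n − 1),
-- so if v is satisfied in C₁ it is satisfied in D₁.
module Submission where

open import Defs hiding (sym)
open import Data.Nat using (ℕ; suc; _+_; _*_; _∸_; _≤_; _<_; z≤n)
open import Data.Nat.Properties
open import Data.Fin using (Fin)
open import Data.Fin.Subset
  using (Subset; _∈_; _∉_; _∩_; _∪_; ∁; ⁅_⁆; _⊆_; Nonempty; ⊥; ⊤; ∣_∣; inside; outside)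
open import Data.Fin.Subset.Properties
  using ( x∈p∩q⁺; x∈p∩q⁻; x∈p∪q⁺; x∈p∪q⁻; x∉p⇒x∈∁p; x∈∁p⇒x∉p; _∈?_; ∈⊤; ⊆⊤; ∉⊥
        ; x∈⁅x⁆; x∈⁅y⁆⇒x≡y; ⊆-antisym; Empty-unique; ∩-identityˡ; ∣⊤∣≡n
        ; p⊆q⇒∣p∣≤∣q∣; p⊂q⇒∣p∣<∣q∣; ∣p∩q∣≤∣q∣; x∈p⇒∣p-x∣<∣p∣ )
open import Data.Vec using ([]; _∷_)
open import Data.Vec.Properties using ([]=⇒lookup; lookup∘tabulate)
open import Data.Product using (_×_; _,_; proj₁; proj₂)
open import Data.Sum using (_⊎_; inj₁; inj₂; [_,_])
open import Function using (id; _∘_)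
open import Function.Bundles using (_⇔_; mk⇔; Equivalence)
open import Relation.Nullary using (¬_; yes; no; contradiction)
open import Relation.Binary.PropositionalEquality
  using (_≡_; refl; sym; trans; cong; subst; subst₂; module ≡-Reasoning)

∣p∩q∣+∣p∖q∣≡∣p∣ : ∀ {n} (p q : Subset n) → ∣ p ∩ q ∣ + ∣ p ∖ q ∣ ≡ ∣ p ∣
∣p∩q∣+∣p∖q∣≡∣p∣ []            []            = refl
∣p∩q∣+∣p∖q∣≡∣p∣ (outside ∷ p) (_ ∷ q)       = ∣p∩q∣+∣p∖q∣≡∣p∣ p q
∣p∩q∣+∣p∖q∣≡∣p∣ (inside ∷ p)  (outside ∷ q) =
  trans (+-suc _ _) (cong suc (∣p∩q∣+∣p∖q∣≡∣p∣ p q))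
∣p∩q∣+∣p∖q∣≡∣p∣ (inside ∷ p)  (inside ∷ q)  = cong suc (∣p∩q∣+∣p∖q∣≡∣p∣ p q)

∩≡⊥⇒∉ : ∀ {n x} {p q : Subset n} → p ∩ q ≡ ⊥ → x ∈ p → x ∉ q
∩≡⊥⇒∉ {x = x} p∩q≡⊥ x∈p x∈q = ∉⊥ (subst (x ∈_) p∩q≡⊥ (x∈p∩q⁺ (x∈p , x∈q)))

0<∣p∣ : ∀ {n x} {p : Subset n} → x ∈ p → 0 < ∣ p ∣
0<∣p∣ x∈p = ≤-<-trans z≤n (x∈p⇒∣p-x∣<∣p∣ x∈p)

module Partition {n} {D₁ D₂ : Subset n} (part : IsPartition D₁ D₂) where

  ∈D₁⇒∉D₂ : ∀ {x} → x ∈ D₁ → x ∉ D₂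
  ∈D₁⇒∉D₂ = ∩≡⊥⇒∉ (proj₁ part)

  ∉D₁⇒∈D₂ : ∀ {x} → x ∉ D₁ → x ∈ D₂
  ∉D₁⇒∈D₂ {x} x∉D₁ = [ (λ x∈D₁ → contradiction x∈D₁ x∉D₁) , id ] (x∈p∪q⁻ D₁ D₂ (proj₂ part x))

  ∣p∩D₁∣+∣p∩D₂∣≡∣p∣ : ∀ p → ∣ p ∩ D₁ ∣ + ∣ p ∩ D₂ ∣ ≡ ∣ p ∣
  ∣p∩D₁∣+∣p∩D₂∣≡∣p∣ p =
    trans (cong (λ q → ∣ p ∩ D₁ ∣ + ∣ q ∣) p∩D₂≡p∖D₁) (∣p∩q∣+∣p∖q∣≡∣p∣ p D₁)
    where
    p∩D₂≡p∖D₁ : p ∩ D₂ ≡ p ∖ D₁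
    p∩D₂≡p∖D₁ = ⊆-antisym
      (λ x∈p∩D₂ → let x∈p , x∈D₂ = x∈p∩q⁻ p D₂ x∈p∩D₂ in
        x∈p∩q⁺ (x∈p , x∉p⇒x∈∁p (λ x∈D₁ → ∈D₁⇒∉D₂ x∈D₁ x∈D₂)))
      (λ x∈p∖D₁ → let x∈p , x∈∁D₁ = x∈p∩q⁻ p (∁ D₁) x∈p∖D₁ in
        x∈p∩q⁺ (x∈p , ∉D₁⇒∈D₂ (x∈∁p⇒x∉p x∈∁D₁)))

  ∣D₁∣∸1+∣D₂∣≡n∸1 : ∀ {x} → x ∈ D₁ → (∣ D₁ ∣ ∸ 1) + ∣ D₂ ∣ ≡ n ∸ 1
  ∣D₁∣∸1+∣D₂∣≡n∸1 x∈D₁ = begin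
    (∣ D₁ ∣ ∸ 1) + ∣ D₂ ∣          ≡⟨ +-∸-comm ∣ D₂ ∣ (0<∣p∣ x∈D₁) ⟨
    (∣ D₁ ∣ + ∣ D₂ ∣) ∸ 1          ≡⟨ cong (_∸ 1) ∣D₁∣+∣D₂∣≡n ⟩
    n ∸ 1                          ∎
    where
    open ≡-Reasoning
    ∣D₁∣+∣D₂∣≡n : ∣ D₁ ∣ + ∣ D₂ ∣ ≡ n
    ∣D₁∣+∣D₂∣≡n = begin
      ∣ D₁ ∣ + ∣ D₂ ∣                ≡⟨ cong (λ p → ∣ p ∣ + ∣ D₂ ∣) (∩-identityˡ D₁) ⟨
      ∣ ⊤ ∩ D₁ ∣ + ∣ D₂ ∣            ≡⟨ cong (λ p → ∣ ⊤ ∩ D₁ ∣ + ∣ p ∣) (∩-identityˡ D₂) ⟨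
      ∣ ⊤ ∩ D₁ ∣ + ∣ ⊤ ∩ D₂ ∣        ≡⟨ ∣p∩D₁∣+∣p∩D₂∣≡∣p∣ ⊤ ⟩
      ∣ ⊤ {n} ∣                      ≡⟨ ∣⊤∣≡n n ⟩
      n                              ∎

open Partition

degree : ∀ {n} → Graph n → Fin n → ℕ
degree G v = ∣ N G v ∣

v∉Nv : ∀ {n} (G : Graph n) v → v ∉ N G v
v∉Nv G v v∈N with trans (sym (lookup∘tabulate (adj G v) v)) ([]=⇒lookup v∈N)
... | adj-v-v≡true with trans (sym (irrefl G v)) adj-v-v≡true
... | ()

degree≤n∸1 : ∀ {n} (G : Graph n) v → degree G v ≤ n ∸ 1
degree≤n∸1 {n} G v = ∸-monoˡ-≤ 1 (subst (degree G v <_) (∣⊤∣≡n n)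
  (p⊂q⇒∣p∣<∣q∣ (⊆⊤ , v , ∈⊤ , v∉Nv G v)))

b*x≤a*y⇔[a+b]*x≤a*[x+y] : ∀ {a b x y} → b * x ≤ a * y ⇔ (a + b) * x ≤ a * (x + y)
b*x≤a*y⇔[a+b]*x≤a*[x+y] {a} {b} {x} {y} = mk⇔
  (λ bx≤ay → subst₂ _≤_ (sym (*-distribʳ-+ x a b)) (sym (*-distribˡ-+ a x y))
               (+-monoʳ-≤ (a * x) bx≤ay))
  (λ le → +-cancelˡ-≤ (a * x) _ _
            (subst₂ _≤_ (*-distribʳ-+ x a b) (*-distribˡ-+ a x y) le))

satisfiedIn⇔ : ∀ {n} (G : Graph n) {v Dᵢ Dⱼ} → IsPartition Dᵢ Dⱼ → v ∈ Dᵢ →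
  SatisfiedIn G v Dᵢ Dⱼ ⇔ degree G v * (∣ Dᵢ ∣ ∸ 1) ≤ ∣ NIn G Dᵢ v ∣ * (n ∸ 1)
satisfiedIn⇔ G {v} {Dᵢ} {Dⱼ} part v∈Dᵢ =
  subst₂ (λ k m → SatisfiedIn G v Dᵢ Dⱼ ⇔ k * (∣ Dᵢ ∣ ∸ 1) ≤ ∣ NIn G Dᵢ v ∣ * m)
    (∣p∩D₁∣+∣p∩D₂∣≡∣p∣ part (N G v)) (∣D₁∣∸1+∣D₂∣≡n∸1 part v∈Dᵢ)
    (b*x≤a*y⇔[a+b]*x≤a*[x+y] {a = ∣ NIn G Dᵢ v ∣} {∣ NIn G Dⱼ v ∣} {∣ Dᵢ ∣ ∸ 1} {∣ Dⱼ ∣})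

k*c≤p*m⇒k*d≤[p+t]*m : ∀ {k m c d p t} → k ≤ m → d ≤ c + t → k * c ≤ p * m →
  k * d ≤ (p + t) * m
k*c≤p*m⇒k*d≤[p+t]*m {k} {m} {c} {d} {p} {t} k≤m d≤c+t kc≤pm = begin
  k * d              ≤⟨ *-monoʳ-≤ k d≤c+t ⟩
  k * (c + t)        ≡⟨ *-distribˡ-+ k c t ⟩
  k * c + k * t      ≤⟨ +-mono-≤ kc≤pm (*-monoˡ-≤ t k≤m) ⟩
  p * m + m * t      ≡⟨ cong (p * m +_) (*-comm m t) ⟩
  p * m + t * m      ≡⟨ *-distribʳ-+ m p t ⟨
  (p + t) * m        ∎
  where open ≤-Reasoning

module Regroup {n} (A B M : Subset n) where

  U left right : Subset n
  U     = ⊤ ∖ (A ∪ B)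
  left  = A ∪ (U ∩ M)
  right = B ∪ (U ∖ M)

  ∈U⁻ : ∀ {x} → x ∈ U → x ∉ A × x ∉ B
  ∈U⁻ {x} x∈U = (λ x∈A → x∉A∪B (x∈p∪q⁺ (inj₁ x∈A))) , (λ x∈B → x∉A∪B (x∈p∪q⁺ (inj₂ x∈B)))
    where
    x∉A∪B : x ∉ A ∪ B
    x∉A∪B = x∈∁p⇒x∉p (proj₂ (x∈p∩q⁻ ⊤ _ x∈U))

  ∈U⁺ : ∀ {x} → x ∉ A → x ∉ B → x ∈ U
  ∈U⁺ x∉A x∉B = x∈p∩q⁺ (∈⊤ , x∉p⇒x∈∁p ([ x∉A , x∉B ] ∘ x∈p∪q⁻ A B))

  ∈left : ∀ {x} → x ∉ B → x ∈ M → x ∈ left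
  ∈left {x} x∉B x∈M with x ∈? A
  ... | yes x∈A = x∈p∪q⁺ (inj₁ x∈A)
  ... | no  x∉A = x∈p∪q⁺ (inj₂ (x∈p∩q⁺ (∈U⁺ x∉A x∉B , x∈M)))

  ∈right : ∀ {x} → x ∉ A → x ∉ M → x ∈ right
  ∈right {x} x∉A x∉M with x ∈? B
  ... | yes x∈B = x∈p∪q⁺ (inj₁ x∈B)
  ... | no  x∉B = x∈p∪q⁺ (inj₂ (x∈p∩q⁺ (∈U⁺ x∉A x∉B , x∉p⇒x∈∁p x∉M)))

  left∖A⊆M : ∀ {x} → x ∈ left → x ∉ A → x ∈ M
  left∖A⊆M x∈left x∉A with x∈p∪q⁻ A (U ∩ M) x∈left
  ... | inj₁ x∈A   = contradiction x∈A x∉A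
  ... | inj₂ x∈U∩M = proj₂ (x∈p∩q⁻ U M x∈U∩M)

  isPartition : A ∩ B ≡ ⊥ → IsPartition left right
  isPartition A∩B≡⊥ =
    Empty-unique (λ (x , x∈left∩right) → disjoint (x∈p∩q⁻ left right x∈left∩right)) , cover
    where
    disjoint : ∀ {x} → ¬ (x ∈ left × x ∈ right)
    disjoint (x∈left , x∈right) with x∈p∪q⁻ A (U ∩ M) x∈left | x∈p∪q⁻ B (U ∖ M) x∈right
    ... | inj₁ x∈A | inj₁ x∈B = ∩≡⊥⇒∉ A∩B≡⊥ x∈A x∈B
    ... | inj₁ x∈A | inj₂ x∈U∖M = proj₁ (∈U⁻ (proj₁ (x∈p∩q⁻ U (∁ M) x∈U∖M))) x∈A
    ... | inj₂ x∈U∩M | inj₁ x∈B = proj₂ (∈U⁻ (proj₁ (x∈p∩q⁻ U M x∈U∩M))) x∈B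
    ... | inj₂ x∈U∩M | inj₂ x∈U∖M =
      x∈∁p⇒x∉p (proj₂ (x∈p∩q⁻ U (∁ M) x∈U∖M)) (proj₂ (x∈p∩q⁻ U M x∈U∩M))

    cover : ∀ x → x ∈ left ∪ right
    cover x with x ∈? M | x ∈? A | x ∈? B
    ... | yes x∈M | _       | yes x∈B = x∈p∪q⁺ (inj₂ (x∈p∪q⁺ (inj₁ x∈B)))
    ... | yes x∈M | _       | no  x∉B = x∈p∪q⁺ (inj₁ (∈left x∉B x∈M))
    ... | no  x∉M | yes x∈A | _       = x∈p∪q⁺ (inj₁ (x∈p∪q⁺ (inj₁ x∈A)))
    ... | no  x∉M | no  x∉A | _       = x∈p∪q⁺ (inj₂ (∈right x∉A x∉M))

module Transfer {n} (G : Graph n) {A B C₁ C₂ : Subset n} {v : Fin n}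
  (C-part : IsPartition C₁ C₂) (A∪v⊆C₁ : (A ∪ ⁅ v ⁆) ⊆ C₁) (B⊆C₂ : B ⊆ C₂) where

  open Regroup A B N[ G , v ]

  A⊆C₁ : A ⊆ C₁
  A⊆C₁ = A∪v⊆C₁ ∘ x∈p∪q⁺ ∘ inj₁

  v∈C₁ : v ∈ C₁
  v∈C₁ = A∪v⊆C₁ (x∈p∪q⁺ (inj₂ (x∈⁅x⁆ v)))

  ∈C₁⇒∉B : ∀ {x} → x ∈ C₁ → x ∉ B
  ∈C₁⇒∉B x∈C₁ x∈B = ∈D₁⇒∉D₂ C-part x∈C₁ (B⊆C₂ x∈B)

  v∈left : v ∈ left
  v∈left = ∈left (∈C₁⇒∉B v∈C₁) (x∈p∪q⁺ (inj₂ (x∈⁅x⁆ v)))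

  N∩left∩C₁≡N∩C₁ : NIn G left v ∩ C₁ ≡ NIn G C₁ v
  N∩left∩C₁≡N∩C₁ = ⊆-antisym
    (λ x∈ → let x∈N∩left , x∈C₁ = x∈p∩q⁻ (NIn G left v) C₁ x∈ in
      x∈p∩q⁺ (proj₁ (x∈p∩q⁻ (N G v) left x∈N∩left) , x∈C₁))
    (λ x∈ → let x∈N , x∈C₁ = x∈p∩q⁻ (N G v) C₁ x∈ in
      x∈p∩q⁺ (x∈p∩q⁺ (x∈N , ∈left (∈C₁⇒∉B x∈C₁) (x∈p∪q⁺ (inj₁ x∈N))) , x∈C₁))

  left∖C₁⊆N∩left∖C₁ : left ∖ C₁ ⊆ NIn G left v ∖ C₁
  left∖C₁⊆N∩left∖C₁ {x} x∈left∖C₁ =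
    [ (λ x∈N → x∈p∩q⁺ (x∈p∩q⁺ (x∈N , x∈left) , x∈∁C₁))
    , (λ x∈⁅v⁆ → contradiction (subst (_∈ C₁) (sym (x∈⁅y⁆⇒x≡y v x∈⁅v⁆)) v∈C₁) x∉C₁) ]
    (x∈p∪q⁻ (N G v) ⁅ v ⁆ (left∖A⊆M x∈left (x∉C₁ ∘ A⊆C₁)))
    where
    x∈left : x ∈ left
    x∈left = proj₁ (x∈p∩q⁻ left (∁ C₁) x∈left∖C₁)
    x∈∁C₁ : x ∈ ∁ C₁
    x∈∁C₁ = proj₂ (x∈p∩q⁻ left (∁ C₁) x∈left∖C₁)
    x∉C₁ : x ∉ C₁
    x∉C₁ = x∈∁p⇒x∉p x∈∁C₁

  ∣N∩left∣≡∣N∩C₁∣+∣N∩left∖C₁∣ : ∣ NIn G left v ∣ ≡ ∣ NIn G C₁ v ∣ + ∣ NIn G left v ∖ C₁ ∣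
  ∣N∩left∣≡∣N∩C₁∣+∣N∩left∖C₁∣ = begin
    ∣ NIn G left v ∣
      ≡⟨ ∣p∩q∣+∣p∖q∣≡∣p∣ (NIn G left v) C₁ ⟨
    ∣ NIn G left v ∩ C₁ ∣ + ∣ NIn G left v ∖ C₁ ∣
      ≡⟨ cong (λ p → ∣ p ∣ + ∣ NIn G left v ∖ C₁ ∣) N∩left∩C₁≡N∩C₁ ⟩
    ∣ NIn G C₁ v ∣ + ∣ NIn G left v ∖ C₁ ∣
      ∎
    where open ≡-Reasoning

  ∣left∣∸1≤∣C₁∣∸1+∣N∩left∖C₁∣ : ∣ left ∣ ∸ 1 ≤ (∣ C₁ ∣ ∸ 1) + ∣ NIn G left v ∖ C₁ ∣
  ∣left∣∸1≤∣C₁∣∸1+∣N∩left∖C₁∣ = begin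
    ∣ left ∣ ∸ 1
      ≡⟨ cong (_∸ 1) (∣p∩q∣+∣p∖q∣≡∣p∣ left C₁) ⟨
    (∣ left ∩ C₁ ∣ + ∣ left ∖ C₁ ∣) ∸ 1
      ≤⟨ ∸-monoˡ-≤ 1 (+-mono-≤ (∣p∩q∣≤∣q∣ left C₁) (p⊆q⇒∣p∣≤∣q∣ left∖C₁⊆N∩left∖C₁)) ⟩
    (∣ C₁ ∣ + ∣ NIn G left v ∖ C₁ ∣) ∸ 1
      ≡⟨ +-∸-comm ∣ NIn G left v ∖ C₁ ∣ (0<∣p∣ v∈C₁) ⟩
    (∣ C₁ ∣ ∸ 1) + ∣ NIn G left v ∖ C₁ ∣
      ∎
    where open ≤-Reasoning

  satisfiedIn-C₁⇒satisfiedIn-left : A ∩ B ≡ ⊥ → SatisfiedIn G v C₁ C₂ → SatisfiedIn G v left right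
  satisfiedIn-C₁⇒satisfiedIn-left A∩B≡⊥ v-sat-C₁ =
    Equivalence.from (satisfiedIn⇔ G (isPartition A∩B≡⊥) v∈left)
      (subst (λ a → degree G v * (∣ left ∣ ∸ 1) ≤ a * (n ∸ 1)) (sym ∣N∩left∣≡∣N∩C₁∣+∣N∩left∖C₁∣)
        (k*c≤p*m⇒k*d≤[p+t]*m {p = ∣ NIn G C₁ v ∣} (degree≤n∸1 G v) ∣left∣∸1≤∣C₁∣∸1+∣N∩left∖C₁∣
          (Equivalence.to (satisfiedIn⇔ G C-part v∈C₁) v-sat-C₁)))

mainTheorem10 : ∀ {n} (G : Graph n) (C₁′ C₂′ : Subset n) →
    Nonempty C₁′ → Nonempty C₂′ → C₁′ ∩ C₂′ ≡ ⊥ →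
    (v : Fin n) → v ∈ (⊤ ∖ (C₁′ ∪ C₂′)) →
    ¬ Satisfied G v (C₁′ ∪ ((⊤ ∖ (C₁′ ∪ C₂′)) ∩ N[ G , v ]))
                    (C₂′ ∪ ((⊤ ∖ (C₁′ ∪ C₂′)) ∖ N[ G , v ])) →
    ∀ (C₁ C₂ : Subset n) → (C₁′ ∪ ⁅ v ⁆) ⊆ C₁ → C₂′ ⊆ C₂ →
    ¬ Gen2CS G C₁ C₂
mainTheorem10 G C₁′ C₂′ _ _ C₁′∩C₂′≡⊥ v _ unsatisfied C₁ C₂ C₁′∪v⊆C₁ C₂′⊆C₂
              (_ , _ , C-part , satisfied) =
  unsatisfied ( (λ _ → satisfiedIn-C₁⇒satisfiedIn-left C₁′∩C₂′≡⊥ (proj₁ (satisfied v) v∈C₁))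
              , λ v∈right → contradiction v∈right (∈D₁⇒∉D₂ (isPartition C₁′∩C₂′≡⊥) v∈left) )
  where
  open Regroup C₁′ C₂′ N[ G , v ]
  open Transfer G C-part C₁′∪v⊆C₁ C₂′⊆C₂
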